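{- Let $k$ be a positive integer and let the triangle $uvwu$ bound the outer face of $\mathrm{Tr}(k+10)$. Suppose $\sigma:E(\mathrm{Tr}(k+10))\to\{0,1\}$ is a 2-edge-coloring such that all edges incident with $u$ receive the same color, and there is no monochromatic $C_4$ containing $u$. Then $\mathrm{Tr}(k+10)$ contains a monochromatic copy of $B_k$.
   Context: The iterated triangulation $\mathrm{Tr}(n)$ is the plane graph defined recursively: $\mathrm{Tr}(0)\cong K_3$ is the plane triangle; for $i\ge 0$, $\mathrm{Tr}(i+1)$ is obtained from $\mathrm{Tr}(i)$ by placing a new vertex inside each inner face of $\mathrm{Tr}(i)$ and joining it by edges to the three vertices on the boundary of that face; the outer face of $\mathrm{Tr}(n)$ is bounded by the triangle $\mathrm{Tr}(0)$. A bistar $B_k$ is obtained from one $C_4$ and two disjoint stars $K_{1,k}$ by identifying the centers of the two stars with the two vertices of a pair of non-adjacent vertices of the $C_4$, respectively. A subgraph is monochromatic if all its edges receive the same color. -}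

module Defs where

open import Data.Nat using (ℕ; _<_)
open import Data.Fin using (Fin; zero; suc)
open import Data.Fin.Properties using (_≟_)
import Data.Fin as F
open import Data.Nat.Properties using (<-trans; n<1+n)
open import Data.Unit using (tt)
open import Data.List using (List; []; _∷_; length)
open import Data.Product using (Σ; Σ-syntax; ∃; ∃-syntax; _×_; _,_; proj₁; proj₂)
open import Data.Sum using (_⊎_)
open import Data.Unit using (⊤)
open import Relation.Nullary using (¬_; yes; no)
open import Relation.Binary.PropositionalEquality using (_≡_)
open import Function.Definitions using (Injective)

record Graph : Set₁ where
  field
    Vtx  : Set
    Edg  : Set
    ends : Edg → Vtx × Vtx

open Graph public

Joins : (G : Graph) → Edg G → Vtx G → Vtx G → Set
Joins G e x y = (ends G e ≡ (x , y)) ⊎ (ends G e ≡ (y , x))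

Incident : (G : Graph) → Edg G → Vtx G → Set
Incident G e x = (proj₁ (ends G e) ≡ x) ⊎ (proj₂ (ends G e) ≡ x)

Colouring : Graph → Set
Colouring G = Edg G → Fin 2

MonoCopy : (G : Graph) → Colouring G → (H : Graph) → Fin 2 → (Vtx H → Vtx G) → Set
MonoCopy G σ H c f =
  Injective _≡_ _≡_ f ×
  ((e : Edg H) → Σ[ e′ ∈ Edg G ]
     (Joins G e′ (f (proj₁ (ends H e))) (f (proj₂ (ends H e))) × (σ e′ ≡ c)))

HasMonoCopy : (G : Graph) → Colouring G → Graph → Set
HasMonoCopy G σ H = Σ[ c ∈ Fin 2 ] Σ[ f ∈ (Vtx H → Vtx G) ] MonoCopy G σ H c f

-- Outer vertices: corner 0, corner 1, corner 2 (Tr(0) = K3).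
-- Every inner face of Tr(i) is named by an address α : List (Fin 3) of
-- length i (most recent choice at the head); the empty address is the
-- unique inner face of Tr(0).  The vertex placed into face α is inner α
-- (it exists in Tr(n) iff length α < n).  Face α has corners
-- corners α 0/1/2; its three sub-faces j ∷ α are obtained by replacing
-- corner j by inner α.

data TV : Set where
  corner : Fin 3 → TV
  inner  : List (Fin 3) → TV

corners : List (Fin 3) → Fin 3 → TV
corners []      k = corner k
corners (j ∷ α) k with k ≟ j
... | yes _ = inner α
... | no  _ = corners α k

InTr : ℕ → TV → Set
InTr n (corner _) = ⊤
InTr n (inner α) = length α < n

-- edges of Tr(n): the three outer edges corner a – corner b (a < b),
-- and the three edges from each inserted vertex inner α to the corners
-- of the face α it was placed in.
data TE (n : ℕ) : Set where
  outerE : (a b : Fin 3) → a F.< b → TE n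
  spoke  : (α : List (Fin 3)) → length α < n → Fin 3 → TE n

Tr : ℕ → Graph
Tr n = record
  { Vtx  = Σ TV (InTr n)
  ; Edg  = TE n
  ; ends = endsTr
  }
  where
  endsTr : TE n → Σ TV (InTr n) × Σ TV (InTr n)
  endsTr (outerE a b _) = (corner a , tt) , (corner b , tt)
  endsTr (spoke α p j)  = (inner α , p) , (corners α j , cornersIn α p j)
    where
    cornersIn : (β : List (Fin 3)) → length β < n → (k : Fin 3) → InTr n (corners β k)
    cornersIn []      _ k = tt
    cornersIn (j ∷ β) p k with k ≟ j
    ... | yes _ = <-trans (n<1+n (length β)) p
    ... | no  _ = cornersIn β (<-trans (n<1+n (length β)) p) k

outerV : (n : ℕ) → Fin 3 → Vtx (Tr n)
outerV n i = corner i , tt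

data C4E : Set where
  e01 e12 e23 e30 : C4E

C4 : Graph
C4 = record { Vtx = Fin 4 ; Edg = C4E ; ends = ends4 }
  where
  ends4 : C4E → Fin 4 × Fin 4
  ends4 e01 = zero , suc zero
  ends4 e12 = suc zero , suc (suc zero)
  ends4 e23 = suc (suc zero) , suc (suc (suc zero))
  ends4 e30 = suc (suc (suc zero)) , zero

-- The bistar B_k: a 4-cycle ca – x – cb – y – ca, with k pendant
-- leaves at ca and k pendant leaves at cb (ca, cb non-adjacent on C4).

data BV (k : ℕ) : Set where
  ca cb x y : BV k
  leafA leafB : Fin k → BV k

data BE (k : ℕ) : Set where
  ca-x x-cb cb-y y-ca : BE k
  ca-leaf cb-leaf : Fin k → BE k

Bistar : ℕ → Graph
Bistar k = record { Vtx = BV k ; Edg = BE k ; ends = endsB }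
  where
  endsB : BE k → BV k × BV k
  endsB ca-x = ca , x
  endsB x-cb = x , cb
  endsB cb-y = cb , y
  endsB y-ca = y , ca
  endsB (ca-leaf i) = ca , leafA i
  endsB (cb-leaf i) = cb , leafB i

-- Let u be the corner all of whose edges have colour c. If a vertex v had
-- c-coloured edges to two distinct neighbours s, t of u, then u s v t would be
-- a monochromatic C4 through u; so every vertex has at most one c-edge into
-- the neighbourhood of u, and all its other edges into it have the other
-- colour c′. The centre P of Tr(1) and the ladder Q₀, Q₁, … (Qⱼ₊₁ placed in
-- the face P Qⱼ u) are neighbours of u, and so is each fan of k+1 vertices
-- placed one inside the other in the faces at u along an edge v u; such a fan
-- therefore gives k leaves joined to v in colour c′. If some rung Qⱼ Qⱼ₊₁ has
-- colour c, then the 4-cycle Qⱼ P Qⱼ₊₁ Rⱼ, with Rⱼ placed in the face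
-- Qⱼ Qⱼ₊₁ u, has colour c′; otherwise P sends at most one c-edge to
-- Q₁, …, Q₄, which leaves one of the c′-cycles P Q₁ Q₂ Q₃ or P Q₂ Q₃ Q₄.
-- Fans at two opposite vertices of the cycle complete a c′-coloured B_k;
-- their vertices are deeper than the cycle, so everything is distinct, and
-- no vertex used is deeper than k + 9.

module Submission where

open import Defs
open import Data.Empty using (⊥-elim)
open import Data.Fin using (Fin; zero; suc; toℕ; inject₁; punchIn)
open import Data.Fin.Properties
  using (_≟_; 0≢1+n; any?; toℕ-injective; toℕ≤pred[n]; inject₁-injective;
         punchIn-injective; punchInᵢ≢i)
open import Data.List using (List; []; _∷_; length; replicate; _++_)
open import Data.List.Properties using (length-++; length-replicate)
open import Data.Maybe using (Maybe; just; nothing)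
open import Data.Maybe.Properties using (just-injective)
open import Data.Nat using (ℕ; zero; suc; _+_; _≤_; _<_; z≤n; s≤s; z<s)
open import Data.Nat.Properties
  using (_<?_; ≤-refl; ≤-trans; ≤-<-trans; ≤-irrelevant; <⇒≢; n≤1+n; n<1+n;
         m≤n⇒m≤1+n; m<n⇒m<1+n; m≤n+m; +-comm; +-suc; +-mono-≤; +-cancelʳ-≡;
         suc-injective; module ≤-Reasoning)
open import Data.Product using (Σ-syntax; _×_; _,_; proj₁; proj₂)
open import Data.Sum using (_⊎_; inj₁; inj₂; [_,_])
open import Data.Vec using ([]; _∷_; lookup)
open import Data.Vec.Relation.Unary.All using (All; []; _∷_)
open import Data.Vec.Relation.Unary.All.Properties using (lookup⁺)
open import Data.Vec.Relation.Unary.AllPairs using ([]; _∷_)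
open import Data.Vec.Relation.Unary.Unique.Propositional using (Unique)
open import Data.Vec.Relation.Unary.Unique.Propositional.Properties using (lookup-injective)
open import Function using (_∘_)
open import Function.Definitions using (Injective)
open import Relation.Nullary using (¬_; yes; no)
open import Relation.Nullary.Decidable using (recompute)
open import Relation.Binary.PropositionalEquality
  using (_≡_; _≢_; refl; sym; trans; cong; subst; ≢-sym; module ≡-Reasoning)

other : Fin 2 → Fin 2
other zero       = suc zero
other (suc zero) = zero

≢⇒≡other : {c d : Fin 2} → d ≢ c → d ≡ other c
≢⇒≡other {zero}     {zero}     d≢c = ⊥-elim (d≢c refl)
≢⇒≡other {zero}     {suc zero} _   = refl
≢⇒≡other {suc zero} {zero}     _   = refl
≢⇒≡other {suc zero} {suc zero} d≢c = ⊥-elim (d≢c refl)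

[,]-injective : {A B C : Set} {f : A → C} {g : B → C} →
  Injective _≡_ _≡_ f → Injective _≡_ _≡_ g → (∀ a b → f a ≢ g b) →
  Injective _≡_ _≡_ [ f , g ]
[,]-injective f-inj g-inj f≢g {inj₁ a} {inj₁ a′} eq = cong inj₁ (f-inj eq)
[,]-injective f-inj g-inj f≢g {inj₁ a} {inj₂ b}  eq = ⊥-elim (f≢g a b eq)
[,]-injective f-inj g-inj f≢g {inj₂ b} {inj₁ a}  eq = ⊥-elim (f≢g a b (sym eq))
[,]-injective f-inj g-inj f≢g {inj₂ b} {inj₂ b′} eq = cong inj₂ (g-inj eq)

bistarRole : ∀ {k} → BV k → Fin 4 ⊎ (Fin k ⊎ Fin k)
bistarRole ca        = inj₁ zero
bistarRole x         = inj₁ (suc zero)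
bistarRole cb        = inj₁ (suc (suc zero))
bistarRole y         = inj₁ (suc (suc (suc zero)))
bistarRole (leafA t) = inj₂ (inj₁ t)
bistarRole (leafB t) = inj₂ (inj₂ t)

roleVertex : ∀ {k} → Fin 4 ⊎ (Fin k ⊎ Fin k) → BV k
roleVertex (inj₁ zero)                   = ca
roleVertex (inj₁ (suc zero))             = x
roleVertex (inj₁ (suc (suc zero)))       = cb
roleVertex (inj₁ (suc (suc (suc zero)))) = y
roleVertex (inj₂ (inj₁ t))               = leafA t
roleVertex (inj₂ (inj₂ t))               = leafB t

roleVertex-bistarRole : ∀ {k} (p : BV k) → roleVertex (bistarRole p) ≡ p
roleVertex-bistarRole ca        = refl
roleVertex-bistarRole x         = refl
roleVertex-bistarRole cb        = refl
roleVertex-bistarRole y         = refl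
roleVertex-bistarRole (leafA t) = refl
roleVertex-bistarRole (leafB t) = refl

bistarRole-injective : ∀ {k} → Injective _≡_ _≡_ (bistarRole {k})
bistarRole-injective {k} {p} {q} eq = begin
  p                          ≡⟨ roleVertex-bistarRole p ⟨
  roleVertex (bistarRole p)  ≡⟨ cong roleVertex eq ⟩
  roleVertex (bistarRole q)  ≡⟨ roleVertex-bistarRole q ⟩
  q                          ∎
  where open ≡-Reasoning

module _ (G : Graph) where

  Adjacent : Vtx G → Vtx G → Set
  Adjacent s t = Σ[ e ∈ Edg G ] Joins G e s t

  Joins-sym : ∀ {e s t} → Joins G e s t → Joins G e t s
  Joins-sym (inj₁ eq) = inj₂ eq
  Joins-sym (inj₂ eq) = inj₁ eq

  Adjacent-sym : ∀ {s t} → Adjacent s t → Adjacent t s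
  Adjacent-sym (e , joins) = e , Joins-sym joins

  module _ (σ : Colouring G) where

    MonoEdge : Fin 2 → Vtx G → Vtx G → Set
    MonoEdge c s t = Σ[ e ∈ Edg G ] (Joins G e s t × σ e ≡ c)

    MonoEdge-sym : ∀ {c s t} → MonoEdge c s t → MonoEdge c t s
    MonoEdge-sym (e , joins , colour) = e , Joins-sym joins , colour

    MonoEdge-cases : ∀ c {s t} → Adjacent s t → MonoEdge c s t ⊎ MonoEdge (other c) s t
    MonoEdge-cases c (e , joins) with σ e ≟ c
    ... | yes colour = inj₁ (e , joins , colour)
    ... | no ¬colour = inj₂ (e , joins , ≢⇒≡other ¬colour)

    HasMonoC4Through : Vtx G → Set
    HasMonoC4Through u = Σ[ c ∈ Fin 2 ] Σ[ f ∈ (Vtx C4 → Vtx G) ]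
      (MonoCopy G σ C4 c f × Σ[ j ∈ Vtx C4 ] (f j ≡ u))

    monoC4 : ∀ {c u s v t} → Unique (u ∷ s ∷ v ∷ t ∷ []) →
      MonoEdge c u s → MonoEdge c s v → MonoEdge c v t → MonoEdge c t u →
      HasMonoC4Through u
    monoC4 {c} {u} {s} {v} {t} distinct us sv vt tu =
      c , f , ((λ {p} {q} → lookup-injective distinct p q) , edge) , zero , refl
      where
      f : Fin 4 → Vtx G
      f = lookup (u ∷ s ∷ v ∷ t ∷ [])
      edge : (e : C4E) → MonoEdge c (f (proj₁ (ends C4 e))) (f (proj₂ (ends C4 e)))
      edge e01 = us
      edge e12 = sv
      edge e23 = vt
      edge e30 = tu

    module UniformAt (u : Vtx G) (c : Fin 2)
      (uniform : ∀ e → Incident G e u → σ e ≡ c)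
      (noC4 : ¬ HasMonoC4Through u) where

      neighbour-edge : ∀ {s} → Adjacent u s → MonoEdge c u s
      neighbour-edge (e , inj₁ eq) = e , inj₁ eq , uniform e (inj₁ (cong proj₁ eq))
      neighbour-edge (e , inj₂ eq) = e , inj₂ eq , uniform e (inj₂ (cong proj₂ eq))

      forced-other-colour : ∀ {s v t} → Unique (u ∷ s ∷ v ∷ t ∷ []) →
        Adjacent u s → Adjacent u t → MonoEdge c v t → Adjacent v s →
        MonoEdge (other c) v s
      forced-other-colour distinct us ut vt (e , joins) = e , joins , ≢⇒≡other c-coloured⇒C4
        where
        c-coloured⇒C4 : σ e ≢ c
        c-coloured⇒C4 colour = noC4 (monoC4 distinct (neighbour-edge us)
          (MonoEdge-sym (e , joins , colour)) vt (MonoEdge-sym (neighbour-edge ut)))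

      other-coloured-fan : ∀ {k} (v : Vtx G) (w : Fin (suc k) → Vtx G) →
        Injective _≡_ _≡_ w → u ≢ v → (∀ t → u ≢ w t) → (∀ t → w t ≢ v) →
        (∀ t → Adjacent u (w t)) → (∀ t → Adjacent v (w t)) →
        Σ[ g ∈ (Fin k → Fin (suc k)) ]
          (Injective _≡_ _≡_ g × (∀ t → MonoEdge (other c) v (w (g t))))
      other-coloured-fan v w w-inj u≢v u≢w w≢v uw vw
        with any? (λ t → σ (proj₁ (vw t)) ≟ c)
      ... | no none =
        inject₁ , inject₁-injective ,
        λ t → proj₁ (vw (inject₁ t)) , proj₂ (vw (inject₁ t)) ,
              ≢⇒≡other (λ colour → none (inject₁ t , colour))
      ... | yes (t₀ , colour₀) =
        punchIn t₀ , punchIn-injective t₀ _ _ ,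
        λ t → forced-other-colour (distinct t) (uw _) (uw t₀)
                (proj₁ (vw t₀) , proj₂ (vw t₀) , colour₀) (vw _)
        where
        distinct : ∀ t → Unique (u ∷ w (punchIn t₀ t) ∷ v ∷ w t₀ ∷ [])
        distinct t = (u≢w _ ∷ u≢v ∷ u≢w t₀ ∷ [])
                   ∷ (w≢v _ ∷ punchInᵢ≢i t₀ t ∘ w-inj ∷ [])
                   ∷ (≢-sym (w≢v t₀) ∷ [])
                   ∷ [] ∷ []

    monoBistar : ∀ {k d A X B Y} {ℓA ℓB : Fin k → Vtx G} →
      let cycle = A ∷ X ∷ B ∷ Y ∷ [] in
      Unique cycle → Injective _≡_ _≡_ ℓA → Injective _≡_ _≡_ ℓB →
      (∀ p t → lookup cycle p ≢ ℓA t) → (∀ p t → lookup cycle p ≢ ℓB t) →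
      (∀ s t → ℓA s ≢ ℓB t) →
      MonoEdge d A X → MonoEdge d X B → MonoEdge d B Y → MonoEdge d Y A →
      (∀ t → MonoEdge d A (ℓA t)) → (∀ t → MonoEdge d B (ℓB t)) →
      HasMonoCopy G σ (Bistar k)
    monoBistar {k} {d} {A} {X} {B} {Y} {ℓA} {ℓB}
      distinct ℓA-inj ℓB-inj cycle≢ℓA cycle≢ℓB ℓA≢ℓB
      AX XB BY YA A-ℓA B-ℓB =
      d , f , f-injective , edge
      where
      onRoles : Fin 4 ⊎ (Fin k ⊎ Fin k) → Vtx G
      onRoles = [ lookup (A ∷ X ∷ B ∷ Y ∷ []) , [ ℓA , ℓB ] ]
      f : BV k → Vtx G
      f = onRoles ∘ bistarRole
      f-injective : Injective _≡_ _≡_ f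
      f-injective = bistarRole-injective ∘
        [,]-injective (λ {p} {q} → lookup-injective distinct p q)
          ([,]-injective ℓA-inj ℓB-inj ℓA≢ℓB)
          (λ p → [ cycle≢ℓA p , cycle≢ℓB p ])
      edge : (e : BE k) → MonoEdge d (f (proj₁ (ends (Bistar k) e))) (f (proj₂ (ends (Bistar k) e)))
      edge ca-x        = AX
      edge x-cb        = XB
      edge cb-y        = BY
      edge y-ca        = YA
      edge (ca-leaf t) = A-ℓA t
      edge (cb-leaf t) = B-ℓB t

corners-∷-≡ : ∀ χ β → corners (χ ∷ β) χ ≡ inner β
corners-∷-≡ χ β with χ ≟ χ
... | yes _   = refl
... | no χ≢χ = ⊥-elim (χ≢χ refl)

corners-∷-≢ : ∀ {χ ψ} β → ψ ≢ χ → corners (χ ∷ β) ψ ≡ corners β ψ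
corners-∷-≢ {χ} {ψ} β ψ≢χ with ψ ≟ χ
... | yes ψ≡χ = ⊥-elim (ψ≢χ ψ≡χ)
... | no _    = refl

corners-replicate-++ : ∀ {χ ψ} m β → ψ ≢ χ → corners (replicate m χ ++ β) ψ ≡ corners β ψ
corners-replicate-++         zero    β ψ≢χ = refl
corners-replicate-++ {χ} {ψ} (suc m) β ψ≢χ =
  trans (corners-∷-≢ (replicate m χ ++ β) ψ≢χ) (corners-replicate-++ m β ψ≢χ)

length-replicate-++ : ∀ m (χ : Fin 3) β → length (replicate m χ ++ β) ≡ m + length β
length-replicate-++ m χ β = trans (length-++ (replicate m χ)) (cong (_+ length β) (length-replicate m))

module _ {n : ℕ} where

  -- The depth bound is irrelevant, so a vertex, and a spoke at it, is
  -- determined by its address up to definitional equality.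
  node : (α : List (Fin 3)) → .(length α < n) → Vtx (Tr n)
  node α p = inner α , recompute (length α <? n) p

  depth : Vtx (Tr n) → ℕ
  depth (corner _ , _) = 0
  depth (inner α , _)  = length α

  firstLetter : Vtx (Tr n) → Maybe (Fin 3)
  firstLetter (inner (χ ∷ _) , _) = just χ
  firstLetter _                   = nothing

  shallower⇒≢ : ∀ {s t : Vtx (Tr n)} → depth s < depth t → s ≢ t
  shallower⇒≢ lt eq = <⇒≢ lt (cong depth eq)

  node-injective : ∀ {α β} .{p q} → node α p ≡ node β q → α ≡ β
  node-injective refl = refl

  spoke-adjacent : ∀ {α β} j .(p : length α < n) .(q : length β < n) →
    corners α j ≡ inner β → Adjacent (Tr n) (node α p) (node β q)
  spoke-adjacent {α} {β} j p q α-β = spoke α _ j , inj₁ (cong (node α p ,_) (target _ α-β))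
    where
    target : (w : Vtx (Tr n)) → proj₁ w ≡ inner β → w ≡ node β q
    target (_ , r) refl = cong (inner β ,_) (≤-irrelevant r _)

  corner-adjacent : ∀ {α j} .(p : length α < n) →
    corners α j ≡ corner j → Adjacent (Tr n) (outerV n j) (node α p)
  corner-adjacent {α} {j} p α-j = spoke α _ j , inj₂ (cong (node α p ,_) (target _ α-j))
    where
    target : (w : Vtx (Tr n)) → proj₁ w ≡ corner j → w ≡ outerV n j
    target (_ , _) refl = refl

module AroundCorner (k : ℕ) (i a b : Fin 3) (a≢i : a ≢ i) (b≢i : b ≢ i) (a≢b : a ≢ b)
  (σ : Colouring (Tr (k + 10))) (c : Fin 2)
  (uniform : ∀ e → Incident (Tr (k + 10)) e (outerV (k + 10) i) → σ e ≡ c)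
  (noC4 : ¬ HasMonoC4Through (Tr (k + 10)) σ (outerV (k + 10) i)) where

  N : ℕ
  N = k + 10

  G : Graph
  G = Tr N

  u : Vtx G
  u = outerV N i

  open UniformAt G σ u c uniform noC4

  c′ : Fin 2
  c′ = other c

  fan<N : ∀ {l m} → l ≤ k → m ≤ 8 → suc (l + m) < N
  fan<N {l} {m} l≤k m≤8 = begin
    suc (suc (l + m)) ≤⟨ s≤s (s≤s (+-mono-≤ l≤k m≤8)) ⟩
    suc (suc (k + 8)) ≡⟨ cong suc (+-suc k 8) ⟨
    suc (k + 9)       ≡⟨ +-suc k 9 ⟨
    k + 10            ∎
    where open ≤-Reasoning

  short<N : ∀ {m} → m ≤ 8 → m < N
  short<N m≤8 = ≤-trans (n≤1+n _) (fan<N z≤n m≤8)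

  record Fan (v : Vtx G) (m : ℕ) (χ : Fin 3) : Set where
    field
      leaf             : Fin k → Vtx G
      leaf-injective   : Injective _≡_ _≡_ leaf
      leaf-edge        : ∀ t → MonoEdge G σ c′ v (leaf t)
      leaf-deeper      : ∀ t → m < depth (leaf t)
      leaf-firstLetter : ∀ t → firstLetter (leaf t) ≡ just χ

  fanAt : ∀ A .(pA : length A < N) {χ ψ} → χ ≢ i → ψ ≢ χ → (γ : List (Fin 3)) →
    length γ ≤ 8 → length A ≤ length γ → corners γ ψ ≡ inner A → corners γ i ≡ corner i →
    Fan (node A pA) (length γ) χ
  fanAt A pA {χ} {ψ} χ≢i ψ≢χ γ γ≤8 A≤γ γ-A γ-u = record
    { leaf             = w ∘ g
    ; leaf-injective   = proj₁ (proj₂ recoloured) ∘ w-injective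
    ; leaf-edge        = proj₂ (proj₂ recoloured)
    ; leaf-deeper      = deeper ∘ g
    ; leaf-firstLetter = λ _ → refl
    }
    where
    address : ℕ → List (Fin 3)
    address l = replicate (suc l) χ ++ γ

    length-address : ∀ l → length (address l) ≡ suc (l + length γ)
    length-address l = length-replicate-++ (suc l) χ γ

    address-injective : ∀ {l l′} → address l ≡ address l′ → l ≡ l′
    address-injective {l} {l′} eq = +-cancelʳ-≡ (length γ) l l′ (suc-injective (begin
      suc (l + length γ)  ≡⟨ length-address l ⟨
      length (address l)  ≡⟨ cong length eq ⟩
      length (address l′) ≡⟨ length-address l′ ⟩
      suc (l′ + length γ) ∎))
      where open ≡-Reasoning

    w : Fin (suc k) → Vtx G
    w t = node (address (toℕ t))
      (subst (_< N) (sym (length-address (toℕ t))) (fan<N (toℕ≤pred[n] t) γ≤8))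

    w-injective : Injective _≡_ _≡_ w
    w-injective = toℕ-injective ∘ address-injective ∘ node-injective

    deeper : ∀ t → length γ < depth (w t)
    deeper t = subst (length γ <_) (sym (length-address (toℕ t))) (s≤s (m≤n+m _ _))

    w≢A : ∀ t → w t ≢ node A pA
    w≢A t = ≢-sym (shallower⇒≢ (≤-<-trans A≤γ (deeper t)))

    u-w : ∀ t → Adjacent G u (w t)
    u-w t = corner-adjacent _ (trans (corners-replicate-++ (suc (toℕ t)) γ (≢-sym χ≢i)) γ-u)

    A-w : ∀ t → Adjacent G (node A pA) (w t)
    A-w t = Adjacent-sym G (spoke-adjacent ψ _ pA
      (trans (corners-replicate-++ (suc (toℕ t)) γ ψ≢χ) γ-A))

    recoloured : Σ[ g ∈ (Fin k → Fin (suc k)) ]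
      (Injective _≡_ _≡_ g × (∀ t → MonoEdge G σ c′ (node A pA) (w (g t))))
    recoloured = other-coloured-fan (node A pA) w w-injective (λ ()) (λ _ ()) w≢A u-w A-w

    g : Fin k → Fin (suc k)
    g = proj₁ recoloured

  bistar-from-fans : ∀ {A X B Y m χ ψ} → χ ≢ ψ → Fan A m χ → Fan B m ψ →
    Unique (A ∷ X ∷ B ∷ Y ∷ []) → All (λ v → depth v ≤ m) (A ∷ X ∷ B ∷ Y ∷ []) →
    MonoEdge G σ c′ A X → MonoEdge G σ c′ X B → MonoEdge G σ c′ B Y → MonoEdge G σ c′ Y A →
    HasMonoCopy G σ (Bistar k)
  bistar-from-fans {A} {X} {B} {Y} {m} {χ} {ψ} χ≢ψ fanA fanB distinct shallow AX XB BY YA =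
    monoBistar G σ distinct (leaf-injective fanA) (leaf-injective fanB)
      (cycle≢leaf fanA) (cycle≢leaf fanB) leaves-differ
      AX XB BY YA (leaf-edge fanA) (leaf-edge fanB)
    where
    open Fan

    cycle≢leaf : ∀ {v φ} (F : Fan v m φ) p t → lookup (A ∷ X ∷ B ∷ Y ∷ []) p ≢ leaf F t
    cycle≢leaf F p t = shallower⇒≢ (≤-<-trans (lookup⁺ shallow p) (leaf-deeper F t))

    leaves-differ : ∀ s t → leaf fanA s ≢ leaf fanB t
    leaves-differ s t eq = χ≢ψ (just-injective (begin
      just χ                    ≡⟨ leaf-firstLetter fanA s ⟨
      firstLetter (leaf fanA s) ≡⟨ cong firstLetter eq ⟩
      firstLetter (leaf fanB t) ≡⟨ leaf-firstLetter fanB t ⟩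
      just ψ                    ∎))
      where open ≡-Reasoning

  u≢node : ∀ {α} .{p : length α < N} → u ≢ node α p
  u≢node ()

  uniqueWithU : ∀ {α β γ} .{p : length α < N} .{q : length β < N} .{r : length γ < N} →
    let s = node α p ; v = node β q ; t = node γ r in
    s ≢ v → s ≢ t → v ≢ t → Unique (u ∷ s ∷ v ∷ t ∷ [])
  uniqueWithU s≢v s≢t v≢t =
    (u≢node ∷ u≢node ∷ u≢node ∷ []) ∷ (s≢v ∷ s≢t ∷ []) ∷ (v≢t ∷ []) ∷ [] ∷ []

  -- Q j = bʲa: Q 0 is placed in the face centre–b–u and Q (suc j) in the face
  -- centre–(Q j)–u, so every rung Q j touches both u and the centre.
  Q : ℕ → List (Fin 3)
  Q j = replicate j b ++ a ∷ []

  length-Q : ∀ j → length (Q j) ≡ suc j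
  length-Q j = trans (length-replicate-++ j b _) (+-comm j 1)

  Q-short : ∀ {j} → j ≤ 7 → length (Q j) ≤ 8
  Q-short {j} j≤7 = subst (_≤ 8) (sym (length-Q j)) (s≤s j≤7)

  centre : Vtx G
  centre = node [] (short<N z≤n)

  Q<N : ∀ {j} → j ≤ 7 → length (Q j) < N
  Q<N j≤7 = short<N (Q-short j≤7)

  Q-touches-u : ∀ j → corners (Q j) i ≡ corner i
  Q-touches-u j = trans (corners-replicate-++ j _ (≢-sym b≢i)) (corners-∷-≢ [] (≢-sym a≢i))

  Q-touches-centre : ∀ j → corners (Q j) a ≡ inner []
  Q-touches-centre j = trans (corners-replicate-++ j _ a≢b) (corners-∷-≡ a [])

  u~centre : Adjacent G u centre
  u~centre = corner-adjacent _ refl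

  u~rung : ∀ j .{p : length (Q j) < N} → Adjacent G u (node (Q j) p)
  u~rung j = corner-adjacent _ (Q-touches-u j)

  centre~rung : ∀ j .{p : length (Q j) < N} → Adjacent G centre (node (Q j) p)
  centre~rung j = Adjacent-sym G (spoke-adjacent a _ _ (Q-touches-centre j))

  rung~rung : ∀ j .{p : length (Q j) < N} .{p′ : length (Q (suc j)) < N} →
    Adjacent G (node (Q j) p) (node (Q (suc j)) p′)
  rung~rung j = Adjacent-sym G (spoke-adjacent b _ _ (corners-∷-≡ b (Q j)))

  centre≢rung : ∀ j .{p : length (Q j) < N} → centre ≢ node (Q j) p
  centre≢rung j = shallower⇒≢ (subst (0 <_) (sym (length-Q j)) z<s)

  rung-≢ : ∀ {s t} .{ps : length (Q s) < N} .{pt : length (Q t) < N} →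
    s ≢ t → node (Q s) ps ≢ node (Q t) pt
  rung-≢ {s} {t} s≢t eq = s≢t (suc-injective (begin
    suc s            ≡⟨ length-Q s ⟨
    length (Q s)     ≡⟨ cong length (node-injective eq) ⟩
    length (Q t)     ≡⟨ length-Q t ⟩
    suc t            ∎))
    where open ≡-Reasoning

  centre-forced : ∀ s t .{ps : length (Q s) < N} .{pt : length (Q t) < N} → s ≢ t →
    MonoEdge G σ c centre (node (Q t) pt) → MonoEdge G σ c′ centre (node (Q s) ps)
  centre-forced s t s≢t centre-t = forced-other-colour
    (uniqueWithU (≢-sym (centre≢rung s)) (rung-≢ s≢t) (centre≢rung t))
    (u~rung s) (u~rung t) centre-t (centre~rung s)

  module Ladder (j : ℕ) (j≤5 : j ≤ 5) where

    -- r is placed in the face q₁–q₀–u.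
    q₀ q₁ q₂ r : Vtx G
    q₀ = node (Q j) (Q<N (m≤n⇒m≤1+n (m≤n⇒m≤1+n j≤5)))
    q₁ = node (Q (suc j)) (Q<N (m≤n⇒m≤1+n (s≤s j≤5)))
    q₂ = node (Q (suc (suc j))) (Q<N (s≤s (s≤s j≤5)))
    r  = node (a ∷ Q (suc j)) (Q<N (s≤s (s≤s j≤5)))

    top : ℕ
    top = length (Q (suc (suc j)))

    top≤8 : top ≤ 8
    top≤8 = Q-short (s≤s (s≤s j≤5))

    q₀≤top : depth q₀ ≤ top
    q₀≤top = m≤n⇒m≤1+n (n≤1+n _)

    q₀<top : depth q₀ < top
    q₀<top = m<n⇒m<1+n (n<1+n _)

    q₀~q₁ : Adjacent G q₀ q₁
    q₀~q₁ = rung~rung j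

    centre~q₀ : Adjacent G centre q₀
    centre~q₀ = centre~rung j

    centre~q₂ : Adjacent G centre q₂
    centre~q₂ = centre~rung (suc (suc j))

    fan-q₁ : Fan q₁ top a
    fan-q₁ = fanAt (Q (suc j)) _ a≢i (≢-sym a≢b) (Q (suc (suc j))) top≤8 (n≤1+n _)
      (corners-∷-≡ b (Q (suc j))) (Q-touches-u (suc (suc j)))

    bistar-through-centre :
      MonoEdge G σ c′ centre q₀ → MonoEdge G σ c′ q₀ q₁ →
      MonoEdge G σ c′ q₁ q₂ → MonoEdge G σ c′ q₂ centre → HasMonoCopy G σ (Bistar k)
    bistar-through-centre =
      bistar-from-fans (≢-sym a≢b) fan-centre fan-q₁
        ((centre≢rung j ∷ shallower⇒≢ z<s ∷ shallower⇒≢ z<s ∷ [])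
          ∷ (shallower⇒≢ (n<1+n _) ∷ shallower⇒≢ q₀<top ∷ [])
          ∷ (shallower⇒≢ (n<1+n _) ∷ [])
          ∷ [] ∷ [])
        (z≤n ∷ q₀≤top ∷ n≤1+n _ ∷ ≤-refl ∷ [])
      where
      fan-centre : Fan centre top b
      fan-centre = fanAt [] _ b≢i a≢b (Q (suc (suc j))) top≤8 z≤n
        (Q-touches-centre (suc (suc j))) (Q-touches-u (suc (suc j)))

    bistar-across-rung : MonoEdge G σ c q₀ q₁ → HasMonoCopy G σ (Bistar k)
    bistar-across-rung q₀-q₁ =
      bistar-from-fans (≢-sym a≢b) fan-q₀ fan-q₁
        ((≢-sym centre≢q₀ ∷ q₀≢q₁ ∷ q₀≢r ∷ []) ∷ (centre≢q₁ ∷ centre≢r ∷ []) ∷ (q₁≢r ∷ []) ∷ [] ∷ [])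
        (q₀≤top ∷ z≤n ∷ n≤1+n _ ∷ ≤-refl ∷ [])
        q₀-centre (MonoEdge-sym G σ q₁-centre) q₁-r (MonoEdge-sym G σ q₀-r)
      where
      centre≢q₀ : centre ≢ q₀
      centre≢q₀ = centre≢rung j
      centre≢q₁ : centre ≢ q₁
      centre≢q₁ = shallower⇒≢ z<s
      centre≢r : centre ≢ r
      centre≢r = shallower⇒≢ z<s
      q₀≢q₁ : q₀ ≢ q₁
      q₀≢q₁ = shallower⇒≢ (n<1+n _)
      q₀≢r : q₀ ≢ r
      q₀≢r = shallower⇒≢ q₀<top
      q₁≢r : q₁ ≢ r
      q₁≢r = shallower⇒≢ (n<1+n _)

      u~r : Adjacent G u r
      u~r = corner-adjacent _ (trans (corners-∷-≢ _ (≢-sym a≢i)) (Q-touches-u (suc j)))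

      q₁~r : Adjacent G q₁ r
      q₁~r = Adjacent-sym G (spoke-adjacent a _ _ (corners-∷-≡ a (Q (suc j))))

      q₀~r : Adjacent G q₀ r
      q₀~r = Adjacent-sym G (spoke-adjacent b _ _
        (trans (corners-∷-≢ _ (≢-sym a≢b)) (corners-∷-≡ b (Q j))))

      q₀-centre : MonoEdge G σ c′ q₀ centre
      q₀-centre = forced-other-colour (uniqueWithU centre≢q₀ centre≢q₁ q₀≢q₁)
        u~centre (u~rung (suc j)) q₀-q₁ (Adjacent-sym G centre~q₀)

      q₁-centre : MonoEdge G σ c′ q₁ centre
      q₁-centre = forced-other-colour (uniqueWithU centre≢q₁ centre≢q₀ (≢-sym q₀≢q₁))
        u~centre (u~rung j) (MonoEdge-sym G σ q₀-q₁) (Adjacent-sym G (centre~rung (suc j)))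

      q₁-r : MonoEdge G σ c′ q₁ r
      q₁-r = forced-other-colour (uniqueWithU (≢-sym q₁≢r) (≢-sym q₀≢r) (≢-sym q₀≢q₁))
        u~r (u~rung j) (MonoEdge-sym G σ q₀-q₁) q₁~r

      q₀-r : MonoEdge G σ c′ q₀ r
      q₀-r = forced-other-colour (uniqueWithU (≢-sym q₀≢r) (≢-sym q₁≢r) q₀≢q₁)
        u~r (u~rung (suc j)) q₀-q₁ q₀~r

      -- The fan at q₀ omits its first vertex b a (Q j), which is as deep as r.
      fan-q₀ : Fan q₀ top b
      fan-q₀ = fanAt (Q j) _ b≢i a≢b (b ∷ a ∷ Q j) top≤8 q₀≤top
        (trans (corners-∷-≢ _ a≢b) (corners-∷-≡ a (Q j)))
        (trans (corners-∷-≢ _ (≢-sym b≢i)) (trans (corners-∷-≢ _ (≢-sym a≢i)) (Q-touches-u j)))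

  module L₁ = Ladder 1 (s≤s z≤n)
  module L₂ = Ladder 2 (s≤s (s≤s z≤n))
  module L₃ = Ladder 3 (s≤s (s≤s (s≤s z≤n)))

  EitherColour : Vtx G → Vtx G → Set
  EitherColour s t = MonoEdge G σ c s t ⊎ MonoEdge G σ c′ s t

  bistar-by-centre : MonoEdge G σ c′ L₁.q₀ L₁.q₁ → MonoEdge G σ c′ L₂.q₀ L₂.q₁ →
    MonoEdge G σ c′ L₃.q₀ L₃.q₁ → EitherColour centre L₁.q₀ → EitherColour centre L₁.q₂ →
    HasMonoCopy G σ (Bistar k)
  bistar-by-centre q₁-q₂ q₂-q₃ q₃-q₄ (inj₂ centre-q₁) (inj₂ centre-q₃) =
    L₁.bistar-through-centre centre-q₁ q₁-q₂ q₂-q₃ (MonoEdge-sym G σ centre-q₃)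
  bistar-by-centre q₁-q₂ q₂-q₃ q₃-q₄ (inj₁ centre-q₁) _ =
    L₂.bistar-through-centre (centre-forced 2 1 (λ ()) centre-q₁) q₂-q₃ q₃-q₄
      (MonoEdge-sym G σ (centre-forced 4 1 (λ ()) centre-q₁))
  bistar-by-centre q₁-q₂ q₂-q₃ q₃-q₄ (inj₂ _) (inj₁ centre-q₃) =
    L₂.bistar-through-centre (centre-forced 2 3 (λ ()) centre-q₃) q₂-q₃ q₃-q₄
      (MonoEdge-sym G σ (centre-forced 4 3 (λ ()) centre-q₃))

  bistar-by-rungs : EitherColour L₁.q₀ L₁.q₁ → EitherColour L₂.q₀ L₂.q₁ →
    EitherColour L₃.q₀ L₃.q₁ → HasMonoCopy G σ (Bistar k)
  bistar-by-rungs (inj₁ q₁-q₂) _           _           = L₁.bistar-across-rung q₁-q₂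
  bistar-by-rungs (inj₂ _)    (inj₁ q₂-q₃) _           = L₂.bistar-across-rung q₂-q₃
  bistar-by-rungs (inj₂ _)    (inj₂ _)    (inj₁ q₃-q₄) = L₃.bistar-across-rung q₃-q₄
  bistar-by-rungs (inj₂ q₁-q₂) (inj₂ q₂-q₃) (inj₂ q₃-q₄) =
    bistar-by-centre q₁-q₂ q₂-q₃ q₃-q₄
      (MonoEdge-cases G σ c L₁.centre~q₀) (MonoEdge-cases G σ c L₁.centre~q₂)

  bistar : HasMonoCopy G σ (Bistar k)
  bistar = bistar-by-rungs (MonoEdge-cases G σ c L₁.q₀~q₁)
    (MonoEdge-cases G σ c L₂.q₀~q₁) (MonoEdge-cases G σ c L₃.q₀~q₁)

lemma5p1 : (k : ℕ) → 1 ≤ k → (i : Fin 3) → (σ : Colouring (Tr (k + 10))) →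
    ((e e′ : Edg (Tr (k + 10))) → Incident (Tr (k + 10)) e (outerV (k + 10) i) →
      Incident (Tr (k + 10)) e′ (outerV (k + 10) i) → σ e ≡ σ e′) →
    ¬ (Σ[ c ∈ Fin 2 ] Σ[ f ∈ (Vtx C4 → Vtx (Tr (k + 10))) ]
        (MonoCopy (Tr (k + 10)) σ C4 c f × Σ[ j ∈ Vtx C4 ] (f j ≡ outerV (k + 10) i))) →
    HasMonoCopy (Tr (k + 10)) σ (Bistar k)
lemma5p1 k _ i σ same-colour noC4 =
  AroundCorner.bistar k i (punchIn i zero) (punchIn i (suc zero))
    (punchInᵢ≢i i _) (punchInᵢ≢i i _) (0≢1+n ∘ punchIn-injective i _ _)
    σ (σ e₀) (λ e e-u → same-colour e e₀ e-u (inj₂ refl)) noC4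
  where
  e₀ : Edg (Tr (k + 10))
  e₀ = spoke [] (≤-trans (s≤s z≤n) (m≤n+m 10 k)) i
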